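{- Let $t\ge 2$ be an integer and let $M$ be a $t$-spike of order at least $4t-4$. Then $M$ is $(2t-1)$-connected.
   Context: A matroid $M$ is a $t$-spike of order $r$ (with $r\ge t$) if there is a partition $(A_1,\dots,A_r)$ of $E(M)$ into 2-element sets such that for every $t$-element $J\subseteq\{1,\dots,r\}$, the set $\bigcup_{j\in J}A_j$ is both a circuit and a cocircuit of $M$. The connectivity function is $\lambda(X)=r(X)+r(E(M)-X)-r(M)$. A partition $(X,E(M)-X)$ is a $k$-separation if $\lambda(X)<k$, $|X|\ge k$ and $|E(M)-X|\ge k$; $M$ is $n$-connected if it has no $k$-separation for any $k<n$. -}

module Defs where

open import Data.Nat using (ℕ; zero; suc; _+_; _∸_; _≤_; _<_)
open import Data.Bool using (Bool; true; false; _∧_; _∨_)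
open import Data.Fin using (Fin; zero; suc)
open import Data.Fin.Subset using (Subset; _∈_; _⊆_; _⊂_; _∪_; _∩_; ∁; ∣_∣; ⊥; ⊤)
open import Data.Vec using (tabulate; lookup)
open import Data.Product using (_×_; ∃)
open import Relation.Binary.PropositionalEquality using (_≡_; _≢_)
open import Relation.Nullary using (¬_)

record Matroid (n : ℕ) : Set where
  field
    rank       : Subset n → ℕ
    rank-bound : ∀ X → rank X ≤ ∣ X ∣
    rank-mono  : ∀ X Y → X ⊆ Y → rank X ≤ rank Y
    rank-submod : ∀ X Y → rank (X ∪ Y) + rank (X ∩ Y) ≤ rank X + rank Y
open Matroid public

module _ {n : ℕ} (M : Matroid n) where

  rk : ℕ
  rk = rank M ⊤

  Independent : Subset n → Set
  Independent X = rank M X ≡ ∣ X ∣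

  Circuit : Subset n → Set
  Circuit C = ¬ Independent C × (∀ Y → Y ⊂ C → Independent Y)

  -- independent in the dual matroid M*: r*(X) = |X| + r(E - X) - r(M) = |X|,
  -- i.e. r(E - X) = r(M)
  CoIndependent : Subset n → Set
  CoIndependent X = rank M (∁ X) ≡ rk

  Cocircuit : Subset n → Set
  Cocircuit C = ¬ CoIndependent C × (∀ Y → Y ⊂ C → CoIndependent Y)

  -- connectivity function λ(X) = r(X) + r(E - X) - r(M)  (always ≥ 0)
  conn : Subset n → ℕ
  conn X = rank M X + rank M (∁ X) ∸ rk

  Separation : ℕ → Subset n → Set
  Separation k X = conn X < k × k ≤ ∣ X ∣ × k ≤ ∣ ∁ X ∣

  Connected : ℕ → Set
  Connected m = ∀ k → k < m → ∀ X → ¬ Separation k X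

anyFin : ∀ {r} → (Fin r → Bool) → Bool
anyFin {zero}  f = false
anyFin {suc r} f = f zero ∨ anyFin (λ j → f (suc j))

⋃over : ∀ {n r} → (Fin r → Subset n) → Subset r → Subset n
⋃over A J = tabulate (λ e → anyFin (λ j → lookup J j ∧ lookup (A j) e))

IsSpikeWith : ∀ {n} → Matroid n → (t r : ℕ) → (Fin r → Subset n) → Set
IsSpikeWith M t r A =
    t ≤ r
  × (∀ i → ∣ A i ∣ ≡ 2)
  × (∀ i j → i ≢ j → A i ∩ A j ≡ ⊥)
  × (∀ e → ∃ λ i → e ∈ A i)
  × (∀ J → ∣ J ∣ ≡ t → Circuit M (⋃over A J) × Cocircuit M (⋃over A J))

IsSpike : ∀ {n} → Matroid n → (t r : ℕ) → Set
IsSpike {n} M t r = ∃ λ (A : Fin r → Subset n) → IsSpikeWith M t r A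

module Submission where

-- Let A₁,…,Aₘ be the legs and X ⊆ E with k ≤ ∣X∣, ∣E - X∣, k ≤ 2t - 2; we show
-- λ(X) ≥ k using the potential P(S) = r(S) + r(E - S) + ∣S∣ = λ(S) + r(M) + ∣S∣.
-- Moving a set T from E - S into S never lowers P, and raises it by 2 when T
-- meets a circuit-cocircuit that avoids S (potential-mono, potential-jump).  Let
-- N be the legs meeting X, F ⊆ N the legs inside X, and B ⊆ F a set of
-- b = min(∣F∣, t - 1) legs.  The sweep starts at S = U(B), a proper subset of a
-- t-leg circuit-cocircuit, so P = r(M) + 4b, and adds X ∩ Aᵢ for the other legs
-- one at a time.  While at most w = m - b - t met legs have been added, t unused
-- legs remain, so each newly met leg lies in a t-leg circuit-cocircuit avoiding S
-- and P rises by 2.  The sweep ends at S = X with P(X) ≥ r(M) + 4b +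
-- 2 min(∣N∣ - b, w + 1), which sweep-arithmetic turns into λ(X) ≥ k.

open import Defs
open import Data.Nat using (ℕ; zero; suc; _+_; _*_; _∸_; _⊓_; _≤_; _<_; _≤?_; z≤n; s≤s)
open import Data.Nat.Properties
open import Data.Nat.Tactic.RingSolver using (solve-∀)
open import Data.Bool using (Bool; true; false; _∧_; if_then_else_)
open import Data.Bool.Properties using (T-≡)
open import Data.Fin using (Fin; zero; suc) renaming (_≟_ to _≟ᶠ_)
open import Data.Fin.Subset
open import Data.Fin.Subset.Properties
open import Data.Fin.Subset.Induction using (⊂-wellFounded; Acc; acc)
open import Data.Vec using ([]; _∷_; here; there; tabulate)
open import Data.Vec.Properties using (lookup∘tabulate; []=⇒lookup; lookup⇒[]=)
open import Data.Product using (_×_; ∃; _,_; proj₁; proj₂)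
open import Data.Sum using (_⊎_; inj₁; inj₂; [_,_]′)
open import Function using (_∘_; id; case_of_)
open import Function.Bundles using (Equivalence)
open import Relation.Binary.PropositionalEquality
open import Relation.Nullary
open import Relation.Unary using (Decidable)

private
  variable
    n m : ℕ
    p q s : Subset n
    x : Fin n

Disjoint : Subset n → Subset n → Set
Disjoint p q = ∀ {x} → x ∈ p → x ∉ q

∣p∪q∣+∣p∩q∣ : (p q : Subset n) → ∣ p ∪ q ∣ + ∣ p ∩ q ∣ ≡ ∣ p ∣ + ∣ q ∣
∣p∪q∣+∣p∩q∣ []         []         = refl
∣p∪q∣+∣p∩q∣ (true ∷ p) (true ∷ q) =
  cong suc (trans (+-suc _ _) (trans (cong suc (∣p∪q∣+∣p∩q∣ p q)) (sym (+-suc _ _))))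
∣p∪q∣+∣p∩q∣ (true ∷ p)  (false ∷ q) = cong suc (∣p∪q∣+∣p∩q∣ p q)
∣p∪q∣+∣p∩q∣ (false ∷ p) (true ∷ q)  = trans (cong suc (∣p∪q∣+∣p∩q∣ p q)) (sym (+-suc _ _))
∣p∪q∣+∣p∩q∣ (false ∷ p) (false ∷ q) = ∣p∪q∣+∣p∩q∣ p q

∣p∪q∣≤∣p∣+∣q∣ : (p q : Subset n) → ∣ p ∪ q ∣ ≤ ∣ p ∣ + ∣ q ∣
∣p∪q∣≤∣p∣+∣q∣ p q = ≤-trans (m≤m+n _ _) (≤-reflexive (∣p∪q∣+∣p∩q∣ p q))

∣p∪q∣-disjoint : (p q : Subset n) → Disjoint p q → ∣ p ∪ q ∣ ≡ ∣ p ∣ + ∣ q ∣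
∣p∪q∣-disjoint {n} p q p#q = begin
  ∣ p ∪ q ∣               ≡⟨ +-identityʳ _ ⟨
  ∣ p ∪ q ∣ + 0           ≡⟨ cong (∣ p ∪ q ∣ +_) (trans (cong ∣_∣ p∩q≡⊥) (∣⊥∣≡0 n)) ⟨
  ∣ p ∪ q ∣ + ∣ p ∩ q ∣   ≡⟨ ∣p∪q∣+∣p∩q∣ p q ⟩
  ∣ p ∣ + ∣ q ∣           ∎
  where
  open ≡-Reasoning
  p∩q≡⊥ : p ∩ q ≡ ⊥
  p∩q≡⊥ = Empty-unique λ (x , x∈p∩q) → let (x∈p , x∈q) = x∈p∩q⁻ p q x∈p∩q in p#q x∈p x∈q

∉⇒#⁅⁆ : x ∉ p → Disjoint p ⁅ x ⁆
∉⇒#⁅⁆ {x = x} {p = p} x∉p y∈p y∈⁅x⁆ = x∉p (subst (_∈ p) (x∈⁅y⁆⇒x≡y x y∈⁅x⁆) y∈p)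

x∈p⇒⁅x⁆⊆p : x ∈ p → ⁅ x ⁆ ⊆ p
x∈p⇒⁅x⁆⊆p {x = x} {p = p} x∈p y∈⁅x⁆ = subst (_∈ p) (sym (x∈⁅y⁆⇒x≡y x y∈⁅x⁆)) x∈p

∣p∪⁅x⁆∣ : x ∉ p → ∣ p ∪ ⁅ x ⁆ ∣ ≡ ∣ p ∣ + 1
∣p∪⁅x⁆∣ {x = x} {p = p} x∉p = trans (∣p∪q∣-disjoint p ⁅ x ⁆ (∉⇒#⁅⁆ x∉p)) (cong (∣ p ∣ +_) (∣⁅x⁆∣≡1 x))

∣p∪q∩s∣-disjoint : (p q s : Subset n) → Disjoint p q → ∣ (p ∪ q) ∩ s ∣ ≡ ∣ p ∩ s ∣ + ∣ q ∩ s ∣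
∣p∪q∩s∣-disjoint p q s p#q = begin
  ∣ (p ∪ q) ∩ s ∣         ≡⟨ cong ∣_∣ (∩-distribʳ-∪ s p q) ⟩
  ∣ p ∩ s ∪ q ∩ s ∣       ≡⟨ ∣p∪q∣-disjoint (p ∩ s) (q ∩ s) disjoint ⟩
  ∣ p ∩ s ∣ + ∣ q ∩ s ∣   ∎
  where
  open ≡-Reasoning
  disjoint : Disjoint (p ∩ s) (q ∩ s)
  disjoint x∈p∩s x∈q∩s = p#q (proj₁ (x∈p∩q⁻ p s x∈p∩s)) (proj₁ (x∈p∩q⁻ q s x∈q∩s))

x∈p─q⇒x∉q : (p q : Subset n) → x ∈ p ─ q → x ∉ q
x∈p─q⇒x∉q (_ ∷ p) (false ∷ q) here            ()
x∈p─q⇒x∉q (_ ∷ p) (_     ∷ q) (there x∈p─q) (there x∈q) = x∈p─q⇒x∉q p q x∈p─q x∈q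

─-monoˡ : p ⊆ q → p ─ s ⊆ q ─ s
─-monoˡ {p = p} {s = s} p⊆q x∈p─s = x∈p∧x∉q⇒x∈p─q (p⊆q (p─q⊆p p s x∈p─s)) (x∈p─q⇒x∉q p s x∈p─s)

x∉p-x : (p : Subset n) (x : Fin n) → x ∉ p - x
x∉p-x p x x∈p-x = x∈p─q⇒x∉q p ⁅ x ⁆ x∈p-x (x∈⁅x⁆ x)

p-x∪⁅x⁆≡p : x ∈ p → (p - x) ∪ ⁅ x ⁆ ≡ p
p-x∪⁅x⁆≡p {x = x} {p = p} x∈p = ⊆-antisym ⊆p p⊆
  where
  ⊆p : (p - x) ∪ ⁅ x ⁆ ⊆ p
  ⊆p y∈ = [ p─q⊆p p ⁅ x ⁆ , x∈p⇒⁅x⁆⊆p x∈p ]′ (x∈p∪q⁻ _ _ y∈)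
  p⊆ : p ⊆ (p - x) ∪ ⁅ x ⁆
  p⊆ {y} y∈p with y ≟ᶠ x
  ... | yes refl = x∈p∪q⁺ (inj₂ (x∈⁅x⁆ x))
  ... | no  y≢x  = x∈p∪q⁺ (inj₁ (x∈p∧x≢y⇒x∈p-y y∈p y≢x))

∣p-x∣ : x ∈ p → suc ∣ p - x ∣ ≡ ∣ p ∣
∣p-x∣ {x = x} {p = p} x∈p = begin
  suc ∣ p - x ∣                ≡⟨ +-comm 1 _ ⟩
  ∣ p - x ∣ + 1                ≡⟨ cong (∣ p - x ∣ +_) (∣⁅x⁆∣≡1 x) ⟨
  ∣ p - x ∣ + ∣ ⁅ x ⁆ ∣        ≡⟨ ∣p∪q∣-disjoint (p - x) ⁅ x ⁆ (x∈p─q⇒x∉q p ⁅ x ⁆) ⟨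
  ∣ (p - x) ∪ ⁅ x ⁆ ∣          ≡⟨ cong ∣_∣ (p-x∪⁅x⁆≡p x∈p) ⟩
  ∣ p ∣                        ∎
  where open ≡-Reasoning

subset-induction : (P : Subset n → Set) → P ⊥ → (∀ K i → i ∉ K → P K → P (K ∪ ⁅ i ⁆)) → ∀ K → P K
subset-induction P base step K = go K (⊂-wellFounded K)
  where
  go : ∀ K → Acc _⊂_ K → P K
  go K (acc smaller) with nonempty? K
  ... | no  K-empty    = subst P (sym (Empty-unique K-empty)) base
  ... | yes (i , i∈K) =
    subst P (p-x∪⁅x⁆≡p i∈K) (step (K - i) i (x∉p-x K i) (go (K - i) (smaller (x∈p⇒p-x⊂p i∈K))))

extend : (B P : Subset n) (k : ℕ) → B ⊆ P → ∣ B ∣ ≤ k → k ≤ ∣ P ∣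
       → ∃ λ J → B ⊆ J × J ⊆ P × ∣ J ∣ ≡ k
extend []          []         zero    _     _         _         = [] , id , id , refl
extend (true ∷ B)  (true ∷ P) (suc k) B⊆P (s≤s B≤k) (s≤s k≤P)
  with extend B P k (drop-∷-⊆ B⊆P) B≤k k≤P
... | J , B⊆J , J⊆P , ∣J∣ = true ∷ J , s⊆s B⊆J , s⊆s J⊆P , cong suc ∣J∣
extend (true ∷ B)  (false ∷ P) _      B⊆P _ _ = case B⊆P here of λ ()
extend (false ∷ B) (false ∷ P) k      B⊆P B≤k k≤P
  with extend B P k (drop-∷-⊆ B⊆P) B≤k k≤P
... | J , B⊆J , J⊆P , ∣J∣ = false ∷ J , s⊆s B⊆J , s⊆s J⊆P , ∣J∣
extend (false ∷ B) (true ∷ P) k       B⊆P B≤k _ with k ≤? ∣ P ∣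
... | yes k≤P with extend B P k (drop-∷-⊆ B⊆P) B≤k k≤P
...   | J , B⊆J , J⊆P , ∣J∣ = false ∷ J , s⊆s B⊆J , out⊆ J⊆P , ∣J∣
extend (false ∷ B) (true ∷ P) zero    _   _   _ | no k≰P = contradiction z≤n k≰P
extend (false ∷ B) (true ∷ P) (suc k) B⊆P _   (s≤s k≤P) | no k+1≰P
  with extend B P k (drop-∷-⊆ B⊆P) B≤k′ k≤P
  where
  B≤k′ : ∣ B ∣ ≤ k
  B≤k′ = ≤-trans (p⊆q⇒∣p∣≤∣q∣ (drop-∷-⊆ B⊆P)) (≤-pred (≰⇒> k+1≰P))
... | J , B⊆J , J⊆P , ∣J∣ = true ∷ J , out⊆ B⊆J , s⊆s J⊆P , cong suc ∣J∣

truncate : (P : Subset n) (t : ℕ) → 1 ≤ t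
         → ∃ λ B → B ⊆ P × ∣ B ∣ < t × (∣ B ∣ ≡ ∣ P ∣ ⊎ suc ∣ B ∣ ≡ t)
truncate {n} P (suc t) _ with ∣ P ∣ ≤? t
... | yes ∣P∣≤t = P , id , s≤s ∣P∣≤t , inj₁ refl
... | no  ∣P∣≰t with extend ⊥ P t ⊥⊆ (≤-trans (≤-reflexive (∣⊥∣≡0 n)) z≤n) (<⇒≤ (≰⇒> ∣P∣≰t))
...   | B , _ , B⊆P , ∣B∣≡t = B , B⊆P , s≤s (≤-reflexive ∣B∣≡t) , inj₂ (cong suc ∣B∣≡t)

⊆∧∣<∣⇒⊂ : p ⊆ q → ∣ p ∣ < ∣ q ∣ → p ⊂ q
⊆∧∣<∣⇒⊂ {p = p} {q = q} p⊆q ∣p∣<∣q∣ with nonempty? (q ─ p)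
... | yes (x , x∈q─p) = p⊆q , x , p─q⊆p q p x∈q─p , x∈p─q⇒x∉q q p x∈q─p
... | no  q─p-empty  = contradiction (p⊆q⇒∣p∣≤∣q∣ q⊆p) (<⇒≱ ∣p∣<∣q∣)
  where
  q⊆p : q ⊆ p
  q⊆p {x} x∈q with x ∈? p
  ... | yes x∈p = x∈p
  ... | no  x∉p = contradiction (x , x∈p∧x∉q⇒x∈p─q x∈q x∉p) q─p-empty

∣∁p∩q∣+∣p∣ : (p q : Subset n) → p ⊆ q → ∣ ∁ p ∩ q ∣ + ∣ p ∣ ≡ ∣ q ∣
∣∁p∩q∣+∣p∣ []          []          _   = refl
∣∁p∩q∣+∣p∣ (true ∷ p)  (true ∷ q)  p⊆q = trans (+-suc _ _) (cong suc (∣∁p∩q∣+∣p∣ p q (drop-∷-⊆ p⊆q)))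
∣∁p∩q∣+∣p∣ (true ∷ p)  (false ∷ q) p⊆q = case p⊆q here of λ ()
∣∁p∩q∣+∣p∣ (false ∷ p) (true ∷ q)  p⊆q = cong suc (∣∁p∩q∣+∣p∣ p q (drop-∷-⊆ p⊆q))
∣∁p∩q∣+∣p∣ (false ∷ p) (false ∷ q) p⊆q = ∣∁p∩q∣+∣p∣ p q (drop-∷-⊆ p⊆q)

k≤∣∁p∣ : (p : Subset n) (k : ℕ) → ∣ p ∣ + k ≤ n → k ≤ ∣ ∁ p ∣
k≤∣∁p∣ {n} p k ∣p∣+k≤n = begin
  k                  ≡⟨ m+n∸m≡n ∣ p ∣ k ⟨
  ∣ p ∣ + k ∸ ∣ p ∣  ≤⟨ ∸-monoˡ-≤ ∣ p ∣ ∣p∣+k≤n ⟩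
  n ∸ ∣ p ∣          ≡⟨ ∣∁p∣≡n∸∣p∣ p ⟨
  ∣ ∁ p ∣            ∎
  where open ≤-Reasoning

p⊆q⇒p∩q≡p : p ⊆ q → p ∩ q ≡ p
p⊆q⇒p∩q≡p {p = p} {q = q} p⊆q = ⊆-antisym (p∩q⊆p p q) (λ x∈p → x∈p∩q⁺ (x∈p , p⊆q x∈p))

∣⁅x⁆∩p∣≡1 : x ∈ p → ∣ ⁅ x ⁆ ∩ p ∣ ≡ 1
∣⁅x⁆∩p∣≡1 {x = x} {p = p} x∈p =
  trans (cong ∣_∣ (p⊆q⇒p∩q≡p (x∈p⇒⁅x⁆⊆p x∈p))) (∣⁅x⁆∣≡1 x)

∣⁅x⁆∩p∣≡0 : x ∉ p → ∣ ⁅ x ⁆ ∩ p ∣ ≡ 0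
∣⁅x⁆∩p∣≡0 {n} {x = x} {p = p} x∉p = trans (cong ∣_∣ (Empty-unique λ (y , y∈⁅x⁆∩p) →
    let (y∈⁅x⁆ , y∈p) = x∈p∩q⁻ ⁅ x ⁆ p y∈⁅x⁆∩p in ∉⇒#⁅⁆ x∉p y∈p y∈⁅x⁆)) (∣⊥∣≡0 n)

x∈p⇒1≤∣p∣ : x ∈ p → 1 ≤ ∣ p ∣
x∈p⇒1≤∣p∣ {x = x} x∈p = ≤-trans (≤-reflexive (sym (∣⁅x⁆∣≡1 x))) (p⊆q⇒∣p∣≤∣q∣ (x∈p⇒⁅x⁆⊆p x∈p))

1≤∣p∣⇒nonempty : (p : Subset n) → 1 ≤ ∣ p ∣ → Nonempty p
1≤∣p∣⇒nonempty {n} p 1≤∣p∣ with nonempty? p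
... | yes p-nonempty = p-nonempty
... | no  p-empty    = contradiction (trans (cong ∣_∣ (Empty-unique p-empty)) (∣⊥∣≡0 n)) (>⇒≢ 1≤∣p∣)

⟦_⟧ : {P : Fin n → Set} → Decidable P → Subset n
⟦ P? ⟧ = tabulate (λ i → isYes (P? i))

module _ {P : Fin n → Set} (P? : Decidable P) where

  ∈⟦⟧⁻ : x ∈ ⟦ P? ⟧ → P x
  ∈⟦⟧⁻ {x} x∈ = toWitness {a? = P? x} (Equivalence.from T-≡ (trans (sym (lookup∘tabulate _ x)) ([]=⇒lookup x∈)))

  ∈⟦⟧⁺ : P x → x ∈ ⟦ P? ⟧
  ∈⟦⟧⁺ {x} Px = lookup⇒[]= x _ (trans (lookup∘tabulate _ x) (Equivalence.to T-≡ (fromWitness {a? = P? x} Px)))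

∣⁅x⁆∩tabulate∣ : (x : Fin n) (f : Fin n → Bool) → ∣ ⁅ x ⁆ ∩ tabulate f ∣ ≡ (if f x then 1 else 0)
∣⁅x⁆∩tabulate∣ {suc n} zero f with f zero
... | true  = cong suc (trans (cong ∣_∣ (∩-zeroˡ (tabulate (f ∘ suc)))) (∣⊥∣≡0 n))
... | false = trans (cong ∣_∣ (∩-zeroˡ (tabulate (f ∘ suc)))) (∣⊥∣≡0 n)
∣⁅x⁆∩tabulate∣ (suc x) f = ∣⁅x⁆∩tabulate∣ x (f ∘ suc)

module _ (M : Matroid n) where

  private
    r : Subset n → ℕ
    r = rank M

  submodular-⊆ : ∀ {P Q Y Z} → Y ⊆ P ∪ Q → Z ⊆ P ∩ Q → r Y + r Z ≤ r P + r Q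
  submodular-⊆ {P} {Q} Y⊆P∪Q Z⊆P∩Q =
    ≤-trans (+-mono-≤ (rank-mono M _ _ Y⊆P∪Q) (rank-mono M _ _ Z⊆P∩Q)) (rank-submod M P Q)

  rank-∪-≤ : ∀ P Q → r (P ∪ Q) ≤ r P + ∣ Q ∣
  rank-∪-≤ P Q = ≤-trans (m≤m+n _ _) (≤-trans (rank-submod M P Q) (+-monoʳ-≤ (r P) (rank-bound M Q)))

  circuit-spanned : ∀ C T e → Circuit M C → e ∈ C → C ⊆ T → r T ≤ r (T - e)
  circuit-spanned C T e (C-dependent , C-minimal) e∈C C⊆T =
    +-cancelʳ-≤ (r (C - e)) (r T) (r (T - e)) (begin
      r T + r (C - e)      ≤⟨ submodular-⊆ T⊆ (λ x∈C-e → x∈p∩q⁺ (─-monoˡ C⊆T x∈C-e , p─q⊆p C ⁅ e ⁆ x∈C-e)) ⟩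
      r (T - e) + r C      ≤⟨ +-monoʳ-≤ (r (T - e)) rC≤rC-e ⟩
      r (T - e) + r (C - e) ∎)
    where
    open ≤-Reasoning
    T⊆ : T ⊆ (T - e) ∪ C
    T⊆ {x} x∈T with x ≟ᶠ e
    ... | yes refl = x∈p∪q⁺ (inj₂ e∈C)
    ... | no  x≢e  = x∈p∪q⁺ (inj₁ (x∈p∧x≢y⇒x∈p-y x∈T x≢e))
    -- C is dependent while C - e is independent, so r C < ∣ C ∣ = 1 + r (C - e)
    rC≤rC-e : r C ≤ r (C - e)
    rC≤rC-e = ≤-pred (begin-strict
      r C              <⟨ ≤∧≢⇒< (rank-bound M C) C-dependent ⟩
      ∣ C ∣            ≡⟨ ∣p-x∣ e∈C ⟨
      suc ∣ C - e ∣    ≡⟨ cong suc (C-minimal (C - e) (x∈p⇒p-x⊂p e∈C)) ⟨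
      suc (r (C - e))  ∎)

  cocircuit-grows : ∀ D S e → Cocircuit M D → e ∈ D → Disjoint S D → suc (r S) ≤ r (S ∪ ⁅ e ⁆)
  cocircuit-grows D S e (D-codependent , D-minimal) e∈D S#D =
    +-cancelʳ-≤ (r (∁ D)) (suc (r S)) (r (S ∪ ⁅ e ⁆)) (begin-strict
      r S + r (∁ D)         <⟨ +-monoʳ-< (r S) (≤∧≢⇒< (rank-mono M _ _ ⊆⊤) D-codependent) ⟩
      r S + rk M            ≡⟨ +-comm (r S) (rk M) ⟩
      rk M + r S            ≡⟨ cong (_+ r S) (D-minimal (D - e) (x∈p⇒p-x⊂p e∈D)) ⟨
      r (∁ (D - e)) + r S   ≤⟨ submodular-⊆ ∁[D-e]⊆ (λ x∈S → x∈p∩q⁺ (x∈p∪q⁺ (inj₁ x∈S) , x∉p⇒x∈∁p (S#D x∈S))) ⟩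
      r (S ∪ ⁅ e ⁆) + r (∁ D) ∎)
    where
    open ≤-Reasoning
    ∁[D-e]⊆ : ∁ (D - e) ⊆ (S ∪ ⁅ e ⁆) ∪ ∁ D
    ∁[D-e]⊆ {x} x∈∁[D-e] with x ≟ᶠ e
    ... | yes refl = x∈p∪q⁺ (inj₁ (x∈p∪q⁺ (inj₂ (x∈⁅x⁆ x))))
    ... | no  x≢e  = x∈p∪q⁺ (inj₂ (x∉p⇒x∈∁p λ x∈D → x∈∁p⇒x∉p x∈∁[D-e] (x∈p∧x≢y⇒x∈p-y x∈D x≢e)))

  potential : Subset n → ℕ
  potential S = r S + r (∁ S) + ∣ S ∣

  -- Enlarging S by T changes r(S) and r(E - S) by amounts a and c; the potential
  -- then grows by at least a + c, since the size grows by exactly ∣ T ∣.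
  potential-step : ∀ S T a c → Disjoint S T → a + r S ≤ r (S ∪ T)
                 → c + r (∁ S) ≤ r (∁ (S ∪ T)) + ∣ T ∣ → a + c + potential S ≤ potential (S ∪ T)
  potential-step S T a c S#T r-gain r∁-gain = begin
    a + c + (r S + r (∁ S) + ∣ S ∣)                  ≡⟨ regroup a c (r S) (r (∁ S)) ∣ S ∣ ⟩
    (a + r S) + (c + r (∁ S)) + ∣ S ∣                ≤⟨ +-monoˡ-≤ ∣ S ∣ (+-mono-≤ r-gain r∁-gain) ⟩
    r (S ∪ T) + (r (∁ (S ∪ T)) + ∣ T ∣) + ∣ S ∣      ≡⟨ regroup′ (r (S ∪ T)) (r (∁ (S ∪ T))) ∣ T ∣ ∣ S ∣ ⟩
    r (S ∪ T) + r (∁ (S ∪ T)) + (∣ S ∣ + ∣ T ∣)      ≡⟨ cong (r (S ∪ T) + r (∁ (S ∪ T)) +_) (∣p∪q∣-disjoint S T S#T) ⟨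
    potential (S ∪ T)                                ∎
    where
    open ≤-Reasoning
    regroup : ∀ a c x y z → a + c + (x + y + z) ≡ (a + x) + (c + y) + z
    regroup = solve-∀
    regroup′ : ∀ x y t s → x + (y + t) + s ≡ x + y + (s + t)
    regroup′ = solve-∀

  rank-∁-step : ∀ S T → r (∁ S) ≤ r (∁ (S ∪ T)) + ∣ T ∣
  rank-∁-step S T = ≤-trans (rank-mono M _ _ ∁S⊆) (rank-∪-≤ (∁ (S ∪ T)) T)
    where
    ∁S⊆ : ∁ S ⊆ ∁ (S ∪ T) ∪ T
    ∁S⊆ {x} x∈∁S with x ∈? T
    ... | yes x∈T = x∈p∪q⁺ (inj₂ x∈T)
    ... | no  x∉T = x∈p∪q⁺ (inj₁ (x∉p⇒x∈∁p λ x∈S∪T →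
                      [ x∈∁p⇒x∉p x∈∁S , x∉T ]′ (x∈p∪q⁻ S T x∈S∪T)))

  potential-mono : ∀ S T → Disjoint S T → potential S ≤ potential (S ∪ T)
  potential-mono S T S#T =
    potential-step S T 0 0 S#T (rank-mono M _ _ (p⊆p∪q T)) (rank-∁-step S T)

  -- If T meets a set Z that is both a circuit and a cocircuit and avoids S, then
  -- both r(S) and r(E - S) grow when T is moved across, and the potential rises by 2.
  potential-jump : ∀ S T Z e → Disjoint S T → Circuit M Z → Cocircuit M Z → Disjoint Z S
                 → e ∈ Z → e ∈ T → 2 + potential S ≤ potential (S ∪ T)
  potential-jump S T Z e S#T Z-circuit Z-cocircuit Z#S e∈Z e∈T =
    potential-step S T 1 1 S#T rS-grows r∁S-grows
    where
    open ≤-Reasoning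
    rS-grows : suc (r S) ≤ r (S ∪ T)
    rS-grows = ≤-trans (cocircuit-grows Z S e Z-cocircuit e∈Z (λ x∈S x∈Z → Z#S x∈Z x∈S))
                       (rank-mono M _ _ λ x∈S∪e → [ (λ x∈S → x∈p∪q⁺ (inj₁ x∈S)) , (λ x∈⁅e⁆ → x∈p∪q⁺ (inj₂ (x∈p⇒⁅x⁆⊆p e∈T x∈⁅e⁆))) ]′
                                                  (x∈p∪q⁻ S ⁅ e ⁆ x∈S∪e))
    ∁S-e⊆ : ∁ S - e ⊆ ∁ (S ∪ T) ∪ (T - e)
    ∁S-e⊆ {x} x∈∁S-e with x ∈? T
    ... | yes x∈T = x∈p∪q⁺ (inj₂ (x∈p∧x∉q⇒x∈p─q x∈T (x∈p─q⇒x∉q (∁ S) ⁅ e ⁆ x∈∁S-e)))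
    ... | no  x∉T = x∈p∪q⁺ (inj₁ (x∉p⇒x∈∁p λ x∈S∪T →
                      [ x∈∁p⇒x∉p (p─q⊆p (∁ S) ⁅ e ⁆ x∈∁S-e) , x∉T ]′ (x∈p∪q⁻ S T x∈S∪T)))
    r∁S-grows : suc (r (∁ S)) ≤ r (∁ (S ∪ T)) + ∣ T ∣
    r∁S-grows = begin
      suc (r (∁ S))                          ≤⟨ s≤s (circuit-spanned Z (∁ S) e Z-circuit e∈Z (λ x∈Z → x∉p⇒x∈∁p (Z#S x∈Z))) ⟩
      suc (r (∁ S - e))                      ≤⟨ s≤s (rank-mono M _ _ ∁S-e⊆) ⟩
      suc (r (∁ (S ∪ T) ∪ (T - e)))          ≤⟨ s≤s (rank-∪-≤ _ _) ⟩
      suc (r (∁ (S ∪ T)) + ∣ T - e ∣)        ≡⟨ +-suc _ _ ⟨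
      r (∁ (S ∪ T)) + suc ∣ T - e ∣          ≡⟨ cong (r (∁ (S ∪ T)) +_) (∣p-x∣ e∈T) ⟩
      r (∁ (S ∪ T)) + ∣ T ∣                  ∎

anyFin⁻ : (f : Fin m → Bool) → anyFin f ≡ true → ∃ λ j → f j ≡ true
anyFin⁻ {suc m} f any-f with f zero in f0
... | true  = zero , f0
... | false = let (j , fj) = anyFin⁻ (f ∘ suc) any-f in suc j , fj

anyFin⁺ : (f : Fin m → Bool) (j : Fin m) → f j ≡ true → anyFin f ≡ true
anyFin⁺ f zero    fj rewrite fj = refl
anyFin⁺ f (suc j) fj with f zero
... | true  = refl
... | false = anyFin⁺ (f ∘ suc) j fj

∧-true⁻ : ∀ {a b} → a ∧ b ≡ true → a ≡ true × b ≡ true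
∧-true⁻ {true} {true} _ = refl , refl

module Legs (A : Fin m → Subset n) where

  U : Subset m → Subset n
  U = ⋃over A

  ∈U⁻ : ∀ K → x ∈ U K → ∃ λ j → j ∈ K × x ∈ A j
  ∈U⁻ {x = x} K x∈UK with anyFin⁻ _ (trans (sym (lookup∘tabulate _ x)) ([]=⇒lookup x∈UK))
  ... | j , Kj∧Ajx = let (Kj , Ajx) = ∧-true⁻ Kj∧Ajx in j , lookup⇒[]= j K Kj , lookup⇒[]= x (A j) Ajx

  ∈U⁺ : ∀ K j → j ∈ K → x ∈ A j → x ∈ U K
  ∈U⁺ {x = x} K j j∈K x∈Aj =
    lookup⇒[]= x _ (trans (lookup∘tabulate _ x) (anyFin⁺ _ j (cong₂ _∧_ ([]=⇒lookup j∈K) ([]=⇒lookup x∈Aj))))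

  U-mono : ∀ {K L} → K ⊆ L → U K ⊆ U L
  U-mono {K} {L} K⊆L x∈UK = let (j , j∈K , x∈Aj) = ∈U⁻ K x∈UK in ∈U⁺ L j (K⊆L j∈K) x∈Aj

  U-⊥ : U ⊥ ≡ ⊥
  U-⊥ = Empty-unique λ (x , x∈U⊥) → let (j , j∈⊥ , _) = ∈U⁻ ⊥ x∈U⊥ in ∉⊥ j∈⊥

  U-insert : ∀ K i → U (K ∪ ⁅ i ⁆) ≡ U K ∪ A i
  U-insert K i = ⊆-antisym ⊆U∪A U∪A⊆
    where
    ⊆U∪A : U (K ∪ ⁅ i ⁆) ⊆ U K ∪ A i
    ⊆U∪A x∈ with ∈U⁻ (K ∪ ⁅ i ⁆) x∈
    ... | j , j∈K∪i , x∈Aj = [ (λ j∈K → x∈p∪q⁺ (inj₁ (∈U⁺ K j j∈K x∈Aj)))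
                             , (λ j∈⁅i⁆ → x∈p∪q⁺ (inj₂ (subst (λ l → _ ∈ A l) (x∈⁅y⁆⇒x≡y i j∈⁅i⁆) x∈Aj))) ]′
                             (x∈p∪q⁻ K ⁅ i ⁆ j∈K∪i)
    U∪A⊆ : U K ∪ A i ⊆ U (K ∪ ⁅ i ⁆)
    U∪A⊆ x∈ = [ U-mono {K} (p⊆p∪q {p = K} ⁅ i ⁆) , ∈U⁺ (K ∪ ⁅ i ⁆) i (x∈p∪q⁺ (inj₂ (x∈⁅x⁆ i))) ]′ (x∈p∪q⁻ _ _ x∈)

  module Disjoint-legs (disjoint : ∀ i j → i ≢ j → A i ∩ A j ≡ ⊥) where

    leg-unique : ∀ {i j} → x ∈ A i → x ∈ A j → i ≡ j
    leg-unique {x = x} {i} {j} x∈Ai x∈Aj with i ≟ᶠ j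
    ... | yes i≡j = i≡j
    ... | no  i≢j = contradiction (subst (x ∈_) (disjoint i j i≢j) (x∈p∩q⁺ (x∈Ai , x∈Aj))) ∉⊥

    U-disjoint : ∀ {K L} → Disjoint K L → Disjoint (U K) (U L)
    U-disjoint {K} {L} K#L x∈UK x∈UL =
      let (j , j∈K , x∈Aj) = ∈U⁻ K x∈UK
          (l , l∈L , x∈Al) = ∈U⁻ L x∈UL
      in K#L j∈K (subst (_∈ L) (leg-unique x∈Al x∈Aj) l∈L)

    U-avoids : ∀ K i → i ∉ K → Disjoint (U K) (A i)
    U-avoids K i i∉K x∈UK x∈Ai = U-disjoint (∉⇒#⁅⁆ i∉K) x∈UK (∈U⁺ ⁅ i ⁆ i (x∈⁅x⁆ i) x∈Ai)

    count-by-legs : (Z : Subset n) (f : Subset m → ℕ) → f ⊥ ≡ 0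
                   → (∀ K i → i ∉ K → f (K ∪ ⁅ i ⁆) ≡ f K + ∣ Z ∩ A i ∣)
                   → ∀ K → ∣ Z ∩ U K ∣ ≡ f K
    count-by-legs Z f f⊥ f-step = subset-induction (λ K → ∣ Z ∩ U K ∣ ≡ f K) base step
      where
      open ≡-Reasoning
      base : ∣ Z ∩ U ⊥ ∣ ≡ f ⊥
      base = begin
        ∣ Z ∩ U ⊥ ∣  ≡⟨ cong (λ V → ∣ Z ∩ V ∣) U-⊥ ⟩
        ∣ Z ∩ ⊥ ∣    ≡⟨ cong ∣_∣ (∩-zeroʳ Z) ⟩
        ∣ ⊥ {n} ∣    ≡⟨ ∣⊥∣≡0 n ⟩
        0            ≡⟨ f⊥ ⟨
        f ⊥          ∎
      step : ∀ K i → i ∉ K → ∣ Z ∩ U K ∣ ≡ f K → ∣ Z ∩ U (K ∪ ⁅ i ⁆) ∣ ≡ f (K ∪ ⁅ i ⁆)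
      step K i i∉K IH = begin
        ∣ Z ∩ U (K ∪ ⁅ i ⁆) ∣          ≡⟨ cong (λ V → ∣ Z ∩ V ∣) (U-insert K i) ⟩
        ∣ Z ∩ (U K ∪ A i) ∣            ≡⟨ cong ∣_∣ (∩-comm Z _) ⟩
        ∣ (U K ∪ A i) ∩ Z ∣            ≡⟨ ∣p∪q∩s∣-disjoint (U K) (A i) Z (U-avoids K i i∉K) ⟩
        ∣ U K ∩ Z ∣ + ∣ A i ∩ Z ∣      ≡⟨ cong₂ _+_ (trans (cong ∣_∣ (∩-comm (U K) Z)) IH) (cong ∣_∣ (∩-comm (A i) Z)) ⟩
        f K + ∣ Z ∩ A i ∣              ≡⟨ f-step K i i∉K ⟨
        f (K ∪ ⁅ i ⁆)                  ∎

-- Here x = ∣ X ∣ and y = ∣ E - X ∣, the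
-- m legs split as b + t + w, ν legs meet X, a of them lie inside X, and b of the
-- latter were used to start the sweep, leaving fr further met legs.
sweep-arithmetic : ∀ t k m w a ν b fr x y
  → k + 2 ≤ 2 * t → 4 * t ≤ m + 4 → b + t + w ≡ m
  → b ≡ a ⊎ suc b ≡ t → a ≤ ν → fr + b ≡ ν → ν ≤ m
  → x ≡ ν + a → x + y ≡ 2 * m → k ≤ x → k ≤ y
  → x + k ≤ 4 * b + 2 * (fr ⊓ suc w)
sweep-arithmetic t k m w a ν b fr x y k+2≤2t 4t≤m+4 refl b-choice a≤ν refl ν≤m refl x+y≡2m k≤x k≤y
  with ≤-total fr (suc w) | b-choice
... | inj₁ fr≤w+1 | inj₁ b≡a rewrite m≤n⇒m⊓n≡m fr≤w+1 = begin
    fr + b + a + k                       ≤⟨ +-monoʳ-≤ (fr + b + a) k≤x ⟩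
    fr + b + a + (fr + b + a)            ≡⟨ cong (λ c → fr + b + c + (fr + b + c)) b≡a ⟨
    fr + b + b + (fr + b + b)            ≡⟨ e₁ fr b ⟩
    4 * b + 2 * fr                       ∎
  where
  open ≤-Reasoning
  e₁ : ∀ fr b → fr + b + b + (fr + b + b) ≡ 4 * b + 2 * fr
  e₁ = solve-∀
... | inj₁ fr≤w+1 | inj₂ refl rewrite m≤n⇒m⊓n≡m fr≤w+1 = begin
    fr + b + a + k                       ≤⟨ +-mono-≤ (+-monoʳ-≤ (fr + b) a≤ν) k≤2b ⟩
    fr + b + (fr + b) + 2 * b            ≡⟨ e₂ fr b ⟩
    4 * b + 2 * fr                       ∎
  where
  open ≤-Reasoning
  e₂ : ∀ fr b → fr + b + (fr + b) + 2 * b ≡ 4 * b + 2 * fr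
  e₂ = solve-∀
  e₃ : ∀ b → 2 * suc b ≡ 2 * b + 2
  e₃ = solve-∀
  k≤2b : k ≤ 2 * b
  k≤2b = +-cancelʳ-≤ 2 k (2 * b) (≤-trans k+2≤2t (≤-reflexive (e₃ b)))
... | inj₂ w+1≤fr | inj₂ refl rewrite m≥n⇒m⊓n≡n w+1≤fr = begin
    fr + b + a + k                       ≤⟨ +-monoʳ-≤ (fr + b + a) k≤y ⟩
    fr + b + a + y                       ≡⟨ x+y≡2m ⟩
    2 * (b + suc b + w)                  ≡⟨ e₄ b w ⟩
    4 * b + 2 * suc w                    ∎
  where
  open ≤-Reasoning
  e₄ : ∀ b w → 2 * (b + suc b + w) ≡ 4 * b + 2 * suc w
  e₄ = solve-∀
... | inj₂ w+1≤fr | inj₁ b≡a rewrite m≥n⇒m⊓n≡n w+1≤fr = +-cancelʳ-≤ (2 + 4 * t) _ _ (begin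
    fr + b + a + k + (2 + 4 * t)                   ≡⟨ cong (λ c → fr + b + c + k + (2 + 4 * t)) b≡a ⟨
    fr + b + b + k + (2 + 4 * t)                   ≡⟨ e₅ (fr + b) b k t ⟩
    (fr + b) + b + (k + 2) + 4 * t                 ≤⟨ +-mono-≤ (+-mono-≤ (+-monoˡ-≤ b ν≤m) k+2≤2t) 4t≤m+4 ⟩
    (b + t + w) + b + 2 * t + (b + t + w + 4)      ≡⟨ e₆ b t w ⟩
    (3 * b + 2 * w + 2) + (2 + 4 * t)              ≤⟨ +-monoˡ-≤ (2 + 4 * t) (+-monoˡ-≤ 2 (+-monoˡ-≤ (2 * w) (*-monoˡ-≤ b (n≤1+n 3)))) ⟩
    (4 * b + 2 * w + 2) + (2 + 4 * t)              ≡⟨ e₇ b w t ⟩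
    4 * b + 2 * suc w + (2 + 4 * t)                ∎)
  where
  open ≤-Reasoning
  e₅ : ∀ ν b k t → ν + b + k + (2 + 4 * t) ≡ ν + b + (k + 2) + 4 * t
  e₅ = solve-∀
  e₆ : ∀ b t w → (b + t + w) + b + 2 * t + (b + t + w + 4) ≡ (3 * b + 2 * w + 2) + (2 + 4 * t)
  e₆ = solve-∀
  e₇ : ∀ b w t → (4 * b + 2 * w + 2) + (2 + 4 * t) ≡ 4 * b + 2 * suc w + (2 + 4 * t)
  e₇ = solve-∀

t+t≤m : ∀ t m → 2 ≤ t → 4 * t ≤ m + 4 → t + t ≤ m
t+t≤m t m 2≤t 4t≤m+4 = +-cancelʳ-≤ 4 (t + t) m (begin
  t + t + 4          ≤⟨ +-monoʳ-≤ (t + t) (+-mono-≤ 2≤t 2≤t) ⟩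
  t + t + (t + t)    ≡⟨ e t ⟩
  4 * t              ≤⟨ 4t≤m+4 ⟩
  m + 4              ∎)
  where
  open ≤-Reasoning
  e : ∀ t → t + t + (t + t) ≡ 4 * t
  e = solve-∀

bound-from-potential : ∀ c d e x k → c + d ≤ e + x → x + k ≤ d → k ≤ e ∸ c
bound-from-potential c d e x k c+d≤e+x x+k≤d = begin
  k                  ≡⟨ m+n∸m≡n c k ⟨
  c + k ∸ c          ≤⟨ ∸-monoˡ-≤ c (+-cancelʳ-≤ x (c + k) e (begin
    c + k + x          ≡⟨ e₁ c k x ⟩
    c + (x + k)        ≤⟨ +-monoʳ-≤ c x+k≤d ⟩
    c + d              ≤⟨ c+d≤e+x ⟩
    e + x              ∎)) ⟩
  e ∸ c              ∎
  where
  open ≤-Reasoning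
  e₁ : ∀ c k x → c + k + x ≡ c + (x + k)
  e₁ = solve-∀

module Spike {t : ℕ} (M : Matroid n) (A : Fin m → Subset n)
  (leg-size : ∀ i → ∣ A i ∣ ≡ 2)
  (legs-disjoint : ∀ i j → i ≢ j → A i ∩ A j ≡ ⊥)
  (legs-cover : ∀ e → ∃ λ i → e ∈ A i)
  (circuit-cocircuit : ∀ J → ∣ J ∣ ≡ t → Circuit M (⋃over A J) × Cocircuit M (⋃over A J))
  where

  open Legs A public
  open Disjoint-legs legs-disjoint public

  ∣U∣ : ∀ K → ∣ U K ∣ ≡ 2 * ∣ K ∣
  ∣U∣ K = trans (cong ∣_∣ (sym (∩-identityˡ (U K))))
                (count-by-legs ⊤ (λ K → 2 * ∣ K ∣) (cong (2 *_) (∣⊥∣≡0 m)) step K)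
    where
    step : ∀ K i → i ∉ K → 2 * ∣ K ∪ ⁅ i ⁆ ∣ ≡ 2 * ∣ K ∣ + ∣ ⊤ ∩ A i ∣
    step K i i∉K = begin
      2 * ∣ K ∪ ⁅ i ⁆ ∣        ≡⟨ cong (2 *_) (∣p∪⁅x⁆∣ i∉K) ⟩
      2 * (∣ K ∣ + 1)          ≡⟨ *-distribˡ-+ 2 ∣ K ∣ 1 ⟩
      2 * ∣ K ∣ + 2            ≡⟨ cong (2 * ∣ K ∣ +_) (trans (sym (leg-size i)) (cong ∣_∣ (sym (∩-identityˡ (A i))))) ⟩
      2 * ∣ K ∣ + ∣ ⊤ ∩ A i ∣  ∎
      where open ≡-Reasoning

  U-⊤ : U ⊤ ≡ ⊤
  U-⊤ = ⊆-antisym ⊆⊤ λ {e} _ → let (i , e∈Ai) = legs-cover e in ∈U⁺ ⊤ i ∈⊤ e∈Ai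

  n≡2m : n ≡ 2 * m
  n≡2m = begin
    n            ≡⟨ ∣⊤∣≡n n ⟨
    ∣ ⊤ {n} ∣    ≡⟨ cong ∣_∣ U-⊤ ⟨
    ∣ U ⊤ ∣      ≡⟨ ∣U∣ ⊤ ⟩
    2 * ∣ ⊤ {m} ∣ ≡⟨ cong (2 *_) (∣⊤∣≡n m) ⟩
    2 * m        ∎
    where open ≡-Reasoning

  module Profile (X : Subset n) where

    load : Fin m → ℕ
    load i = ∣ X ∩ A i ∣

    load≤2 : ∀ i → load i ≤ 2
    load≤2 i = ≤-trans (∣p∩q∣≤∣q∣ X (A i)) (≤-reflexive (leg-size i))

    meets? : Decidable (λ i → 1 ≤ load i)
    meets? i = 1 ≤? load i

    full? : Decidable (λ i → 2 ≤ load i)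
    full? i = 2 ≤? load i

    N F : Subset m
    N = ⟦ meets? ⟧
    F = ⟦ full? ⟧

    F⊆N : F ⊆ N
    F⊆N i∈F = ∈⟦⟧⁺ meets? (≤-trans (s≤s z≤n) (∈⟦⟧⁻ full? i∈F))

    load-split : ∀ i → load i ≡ ∣ ⁅ i ⁆ ∩ N ∣ + ∣ ⁅ i ⁆ ∩ F ∣
    load-split i rewrite ∣⁅x⁆∩tabulate∣ i (isYes ∘ meets?)
                       | ∣⁅x⁆∩tabulate∣ i (isYes ∘ full?)
      with load i | load≤2 i
    ... | 0 | _ = refl
    ... | 1 | _ = refl
    ... | 2 | _ = refl
    ... | suc (suc (suc _)) | s≤s (s≤s ())

    ∣X∩U∣ : ∀ K → ∣ X ∩ U K ∣ ≡ ∣ K ∩ N ∣ + ∣ K ∩ F ∣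
    ∣X∩U∣ = count-by-legs X (λ K → ∣ K ∩ N ∣ + ∣ K ∩ F ∣) base step
      where
      open ≡-Reasoning
      base : ∣ ⊥ ∩ N ∣ + ∣ ⊥ ∩ F ∣ ≡ 0
      base = cong₂ _+_ (trans (cong ∣_∣ (∩-zeroˡ N)) (∣⊥∣≡0 m)) (trans (cong ∣_∣ (∩-zeroˡ F)) (∣⊥∣≡0 m))
      regroup : ∀ a b c d → (a + c) + (b + d) ≡ (a + b) + (c + d)
      regroup = solve-∀
      step : ∀ K i → i ∉ K → ∣ (K ∪ ⁅ i ⁆) ∩ N ∣ + ∣ (K ∪ ⁅ i ⁆) ∩ F ∣ ≡ ∣ K ∩ N ∣ + ∣ K ∩ F ∣ + load i
      step K i i∉K = begin
        ∣ (K ∪ ⁅ i ⁆) ∩ N ∣ + ∣ (K ∪ ⁅ i ⁆) ∩ F ∣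
          ≡⟨ cong₂ _+_ (∣p∪q∩s∣-disjoint K ⁅ i ⁆ N (∉⇒#⁅⁆ i∉K)) (∣p∪q∩s∣-disjoint K ⁅ i ⁆ F (∉⇒#⁅⁆ i∉K)) ⟩
        (∣ K ∩ N ∣ + ∣ ⁅ i ⁆ ∩ N ∣) + (∣ K ∩ F ∣ + ∣ ⁅ i ⁆ ∩ F ∣)
          ≡⟨ regroup ∣ K ∩ N ∣ ∣ K ∩ F ∣ _ _ ⟩
        ∣ K ∩ N ∣ + ∣ K ∩ F ∣ + (∣ ⁅ i ⁆ ∩ N ∣ + ∣ ⁅ i ⁆ ∩ F ∣)
          ≡⟨ cong (∣ K ∩ N ∣ + ∣ K ∩ F ∣ +_) (load-split i) ⟨
        ∣ K ∩ N ∣ + ∣ K ∩ F ∣ + load i ∎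

    -- While at most w legs met by X have been
    -- added, t fresh legs are still available, and each newly met leg raises the
    -- potential by 2; afterwards the potential can only grow.
    module Sweep (B : Subset m) (B⊆F : B ⊆ F) (b<t : ∣ B ∣ < t) (w : ℕ) (room : ∣ B ∣ + t + w ≡ m) where

      b : ℕ
      b = ∣ B ∣

      S : Subset m → Subset n
      S D = X ∩ U (B ∪ D)

      met : Subset m → ℕ
      met D = ∣ D ∩ N ∣

      target : ℕ → ℕ
      target a = rk M + 4 * b + 2 * (a ⊓ suc w)

      Invariant : Subset m → Set
      Invariant D = target (met D) ≤ potential M (S D)

      target-jump : ∀ a → target (suc a) ≤ 2 + target a
      target-jump a = begin
        rk M + 4 * b + 2 * suc (a ⊓ w)        ≡⟨ shift (rk M + 4 * b) (a ⊓ w) ⟩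
        2 + (rk M + 4 * b + 2 * (a ⊓ w))      ≤⟨ +-monoʳ-≤ (2 + (rk M + 4 * b)) (*-monoʳ-≤ 2 (⊓-monoʳ-≤ a (n≤1+n w))) ⟩
        2 + (rk M + 4 * b + 2 * (a ⊓ suc w))  ∎
        where
        open ≤-Reasoning
        shift : ∀ c x → c + 2 * suc x ≡ 2 + (c + 2 * x)
        shift = solve-∀

      target-saturated : ∀ a → w < a → target (suc a) ≡ target a
      target-saturated a w<a = cong (λ z → rk M + 4 * b + 2 * z)
        (trans (cong suc (m≥n⇒m⊓n≡n (<⇒≤ w<a))) (sym (m≥n⇒m⊓n≡n w<a)))

      S-insert : ∀ K i → S (K ∪ ⁅ i ⁆) ≡ S K ∪ X ∩ A i
      S-insert K i = begin
        X ∩ U (B ∪ (K ∪ ⁅ i ⁆))        ≡⟨ cong (λ L → X ∩ U L) (∪-assoc B K ⁅ i ⁆) ⟨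
        X ∩ U ((B ∪ K) ∪ ⁅ i ⁆)        ≡⟨ cong (X ∩_) (U-insert (B ∪ K) i) ⟩
        X ∩ (U (B ∪ K) ∪ A i)          ≡⟨ ∩-distribˡ-∪ X (U (B ∪ K)) (A i) ⟩
        X ∩ U (B ∪ K) ∪ X ∩ A i        ∎
        where open ≡-Reasoning

      S-avoids : ∀ K i → i ∉ B → i ∉ K → Disjoint (S K) (X ∩ A i)
      S-avoids K i i∉B i∉K x∈SK x∈X∩Ai =
        U-avoids (B ∪ K) i (λ i∈B∪K → [ i∉B , i∉K ]′ (x∈p∪q⁻ B K i∈B∪K))
                 (proj₂ (x∈p∩q⁻ X _ x∈SK)) (proj₂ (x∈p∩q⁻ X (A i) x∈X∩Ai))

      used : Subset m → Subset m
      used K = B ∪ K ∩ N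

      S⊆U-used : ∀ K → S K ⊆ U (used K)
      S⊆U-used K x∈SK with x∈p∩q⁻ X (U (B ∪ K)) x∈SK
      ... | x∈X , x∈U with ∈U⁻ (B ∪ K) x∈U
      ... | l , l∈B∪K , x∈Al = ∈U⁺ (used K) l l∈used x∈Al
        where
        l∈used : l ∈ used K
        l∈used = [ (λ l∈B → x∈p∪q⁺ (inj₁ l∈B))
                 , (λ l∈K → x∈p∪q⁺ (inj₂ (x∈p∩q⁺ (l∈K , ∈⟦⟧⁺ meets? (x∈p⇒1≤∣p∣ (x∈p∩q⁺ (x∈X , x∈Al))))))) ]′
                 (x∈p∪q⁻ B K l∈B∪K)

      t≤∣free∣ : ∀ K → met K ≤ w → t ≤ ∣ ∁ (used K) ∣
      t≤∣free∣ K met≤w = k≤∣∁p∣ (used K) t (begin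
        ∣ B ∪ K ∩ N ∣ + t    ≤⟨ +-monoˡ-≤ t (∣p∪q∣≤∣p∣+∣q∣ B (K ∩ N)) ⟩
        b + met K + t        ≤⟨ +-monoˡ-≤ t (+-monoʳ-≤ b met≤w) ⟩
        b + w + t            ≡⟨ swap b w t ⟩
        b + t + w            ≡⟨ room ⟩
        m                    ∎)
        where
        open ≤-Reasoning
        swap : ∀ b w t → b + w + t ≡ b + t + w
        swap = solve-∀

      t≤∣⊤∣ : t ≤ ∣ ⊤ {m} ∣
      t≤∣⊤∣ = ≤-trans (m≤n+m t b) (≤-trans (m≤m+n (b + t) w) (≤-reflexive (trans room (sym (∣⊤∣≡n m)))))

      -- Initially S ⊥ = U B is a proper subset of a t-leg circuit-cocircuit, so it
      -- is independent and coindependent: its potential is r(M) + 4b.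
      base : Invariant ⊥
      base with extend B ⊤ t ⊆⊤ (<⇒≤ b<t) t≤∣⊤∣
      ... | J , B⊆J , _ , ∣J∣≡t = begin
        target (met ⊥)                        ≡⟨ cong target (trans (cong ∣_∣ (∩-zeroˡ N)) (∣⊥∣≡0 m)) ⟩
        rk M + 4 * b + 0                      ≡⟨ arrange (rk M) b ⟩
        (b + b) + rk M + (b + b)              ≡⟨ cong₂ (λ u v → u + v + (b + b)) (sym (trans S⊥-independent ∣S⊥∣)) (sym S⊥-coindependent) ⟩
        rank M (S ⊥) + rank M (∁ (S ⊥)) + (b + b) ≡⟨ cong (rank M (S ⊥) + rank M (∁ (S ⊥)) +_) ∣S⊥∣ ⟨
        potential M (S ⊥)                     ∎
        where
        open ≤-Reasoning
        arrange : ∀ r b → r + 4 * b + 0 ≡ (b + b) + r + (b + b)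
        arrange = solve-∀
        ∣S⊥∣ : ∣ S ⊥ ∣ ≡ b + b
        ∣S⊥∣ = begin-equality
          ∣ S ⊥ ∣                      ≡⟨ ∣X∩U∣ (B ∪ ⊥) ⟩
          ∣ (B ∪ ⊥) ∩ N ∣ + ∣ (B ∪ ⊥) ∩ F ∣ ≡⟨ cong (λ L → ∣ L ∩ N ∣ + ∣ L ∩ F ∣) (∪-identityʳ B) ⟩
          ∣ B ∩ N ∣ + ∣ B ∩ F ∣        ≡⟨ cong₂ _+_ (cong ∣_∣ (p⊆q⇒p∩q≡p (F⊆N ∘ B⊆F))) (cong ∣_∣ (p⊆q⇒p∩q≡p B⊆F)) ⟩
          b + b                        ∎
        S⊥⊂UJ : S ⊥ ⊂ U J
        S⊥⊂UJ = ⊆∧∣<∣⇒⊂ (λ x∈S⊥ → U-mono (subst (_⊆ J) (sym (∪-identityʳ B)) B⊆J) (proj₂ (x∈p∩q⁻ X _ x∈S⊥)))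
                  (begin-strict
                    ∣ S ⊥ ∣      ≡⟨ ∣S⊥∣ ⟩
                    b + b        <⟨ +-mono-< b<t b<t ⟩
                    t + t        ≡⟨ cong (t +_) (sym (+-identityʳ t)) ⟩
                    2 * t        ≡⟨ cong (2 *_) ∣J∣≡t ⟨
                    2 * ∣ J ∣    ≡⟨ ∣U∣ J ⟨
                    ∣ U J ∣      ∎)
        S⊥-independent : rank M (S ⊥) ≡ ∣ S ⊥ ∣
        S⊥-independent = proj₂ (proj₁ (circuit-cocircuit J ∣J∣≡t)) (S ⊥) S⊥⊂UJ
        S⊥-coindependent : rank M (∁ (S ⊥)) ≡ rk M
        S⊥-coindependent = proj₂ (proj₂ (circuit-cocircuit J ∣J∣≡t)) (S ⊥) S⊥⊂UJ

      1≤t : 1 ≤ t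
      1≤t = ≤-trans (s≤s z≤n) b<t

      ⁅i⁆⊆free : ∀ K i → i ∉ B → i ∉ K → ⁅ i ⁆ ⊆ ∁ (used K)
      ⁅i⁆⊆free K i i∉B i∉K x∈⁅i⁆ rewrite x∈⁅y⁆⇒x≡y i x∈⁅i⁆ = x∉p⇒x∈∁p λ i∈used →
        [ i∉B , (λ i∈K∩N → i∉K (proj₁ (x∈p∩q⁻ K N i∈K∩N))) ]′ (x∈p∪q⁻ B (K ∩ N) i∈used)

      -- A leg i met by X, added while met K ≤ w: extend {i} to a set J of t unused
      -- legs; U J is a circuit-cocircuit avoiding S K and meeting X ∩ A i.
      jump : ∀ K i → i ∉ B → i ∉ K → i ∈ N → met K ≤ w
           → 2 + potential M (S K) ≤ potential M (S K ∪ X ∩ A i)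
      jump K i i∉B i∉K i∈N met≤w
        with extend ⁅ i ⁆ (∁ (used K)) t (⁅i⁆⊆free K i i∉B i∉K) (≤-trans (≤-reflexive (∣⁅x⁆∣≡1 i)) 1≤t)
                    (t≤∣free∣ K met≤w)
           | 1≤∣p∣⇒nonempty (X ∩ A i) (∈⟦⟧⁻ meets? i∈N)
      ... | J , ⁅i⁆⊆J , J⊆free , ∣J∣≡t | e , e∈X∩Ai =
        potential-jump M (S K) (X ∩ A i) (U J) e (S-avoids K i i∉B i∉K)
          (proj₁ (circuit-cocircuit J ∣J∣≡t)) (proj₂ (circuit-cocircuit J ∣J∣≡t))
          (λ x∈UJ x∈SK → U-disjoint (λ j∈J j∈used → x∈∁p⇒x∉p (J⊆free j∈J) j∈used) x∈UJ (S⊆U-used K x∈SK))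
          (∈U⁺ J i (⁅i⁆⊆J (x∈⁅x⁆ i)) (proj₂ (x∈p∩q⁻ X (A i) e∈X∩Ai))) e∈X∩Ai

      step : ∀ K i → i ∉ K → (K ⊆ ∁ B → Invariant K) → K ∪ ⁅ i ⁆ ⊆ ∁ B → Invariant (K ∪ ⁅ i ⁆)
      step K i i∉K IH K∪i⊆∁B = subst (λ V → target (met (K ∪ ⁅ i ⁆)) ≤ potential M V) (sym (S-insert K i)) (grow (i ∈? N))
        where
        open ≤-Reasoning
        i∉B : i ∉ B
        i∉B = x∈∁p⇒x∉p (K∪i⊆∁B (x∈p∪q⁺ (inj₂ (x∈⁅x⁆ i))))
        inv : target (met K) ≤ potential M (S K)
        inv = IH (λ x∈K → K∪i⊆∁B (x∈p∪q⁺ (inj₁ x∈K)))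
        mono : potential M (S K) ≤ potential M (S K ∪ X ∩ A i)
        mono = potential-mono M (S K) (X ∩ A i) (S-avoids K i i∉B i∉K)
        met-insert : met (K ∪ ⁅ i ⁆) ≡ met K + ∣ ⁅ i ⁆ ∩ N ∣
        met-insert = ∣p∪q∩s∣-disjoint K ⁅ i ⁆ N (∉⇒#⁅⁆ i∉K)
        grow : Dec (i ∈ N) → target (met (K ∪ ⁅ i ⁆)) ≤ potential M (S K ∪ X ∩ A i)
        grow (no i∉N) = begin
          target (met (K ∪ ⁅ i ⁆))   ≡⟨ cong target (trans met-insert (trans (cong (met K +_) (∣⁅x⁆∩p∣≡0 i∉N)) (+-identityʳ _))) ⟩
          target (met K)             ≤⟨ inv ⟩
          potential M (S K)          ≤⟨ mono ⟩
          potential M (S K ∪ X ∩ A i) ∎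
        grow (yes i∈N) rewrite trans met-insert (trans (cong (met K +_) (∣⁅x⁆∩p∣≡1 i∈N)) (+-comm _ 1))
          with met K ≤? w
        ... | yes met≤w = begin
          target (suc (met K))       ≤⟨ target-jump (met K) ⟩
          2 + target (met K)         ≤⟨ +-monoʳ-≤ 2 inv ⟩
          2 + potential M (S K)      ≤⟨ jump K i i∉B i∉K i∈N met≤w ⟩
          potential M (S K ∪ X ∩ A i) ∎
        ... | no  met≰w = begin
          target (suc (met K))       ≡⟨ target-saturated (met K) (≰⇒> met≰w) ⟩
          target (met K)             ≤⟨ inv ⟩
          potential M (S K)          ≤⟨ mono ⟩
          potential M (S K ∪ X ∩ A i) ∎

      invariant : ∀ D → D ⊆ ∁ B → Invariant D
      invariant = subset-induction (λ D → D ⊆ ∁ B → Invariant D) (λ _ → base) step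

      sweep : target (∣ ∁ B ∩ N ∣) ≤ potential M X
      sweep = subst (λ V → target (met (∁ B)) ≤ potential M V) S∁B≡X (invariant (∁ B) id)
        where
        S∁B≡X : S (∁ B) ≡ X
        S∁B≡X = trans (cong (λ L → X ∩ U L) (p∪∁p≡⊤ B)) (trans (cong (X ∩_) U-⊤) (∩-identityʳ X))

    connectivity-bound : ∀ k → 2 ≤ t → 4 * t ≤ m + 4 → k + 2 ≤ 2 * t
                       → k ≤ ∣ X ∣ → k ≤ ∣ ∁ X ∣ → k ≤ conn M X
    connectivity-bound k 2≤t 4t≤m+4 k+2≤2t k≤∣X∣ k≤∣∁X∣
      with truncate F t (≤-trans (s≤s z≤n) 2≤t)
    ... | B , B⊆F , b<t , b-choice
      with m≤n⇒∃[o]m+o≡n (≤-trans (<⇒≤ (+-monoˡ-< t b<t)) (t+t≤m t m 2≤t 4t≤m+4))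
    ... | w , room =
      bound-from-potential (rk M) (4 * ∣ B ∣ + 2 * (∣ ∁ B ∩ N ∣ ⊓ suc w)) (rank M X + rank M (∁ X)) (∣ X ∣) k
        (≤-trans (≤-reflexive (sym (+-assoc (rk M) _ _))) (Sweep.sweep B B⊆F b<t w room))
        (sweep-arithmetic t k m w (∣ F ∣) (∣ N ∣) (∣ B ∣) (∣ ∁ B ∩ N ∣) (∣ X ∣) (∣ ∁ X ∣) k+2≤2t 4t≤m+4 room b-choice
          (p⊆q⇒∣p∣≤∣q∣ F⊆N) (∣∁p∩q∣+∣p∣ B N (F⊆N ∘ B⊆F)) (∣p∣≤n N) ∣X∣≡∣N∣+∣F∣ ∣X∣+∣∁X∣≡2m k≤∣X∣ k≤∣∁X∣)
      where
      open ≡-Reasoning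
      ∣X∣≡∣N∣+∣F∣ : ∣ X ∣ ≡ ∣ N ∣ + ∣ F ∣
      ∣X∣≡∣N∣+∣F∣ = begin
        ∣ X ∣                   ≡⟨ cong ∣_∣ (trans (cong (X ∩_) U-⊤) (∩-identityʳ X)) ⟨
        ∣ X ∩ U ⊤ ∣             ≡⟨ ∣X∩U∣ ⊤ ⟩
        ∣ ⊤ ∩ N ∣ + ∣ ⊤ ∩ F ∣   ≡⟨ cong₂ (λ P Q → ∣ P ∣ + ∣ Q ∣) (∩-identityˡ N) (∩-identityˡ F) ⟩
        ∣ N ∣ + ∣ F ∣           ∎
      ∣X∣+∣∁X∣≡2m : ∣ X ∣ + ∣ ∁ X ∣ ≡ 2 * m
      ∣X∣+∣∁X∣≡2m = begin
        ∣ X ∣ + ∣ ∁ X ∣         ≡⟨ cong (∣ X ∣ +_) (∣∁p∣≡n∸∣p∣ X) ⟩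
        ∣ X ∣ + (n ∸ ∣ X ∣)     ≡⟨ m+[n∸m]≡n (∣p∣≤n X) ⟩
        n                       ≡⟨ n≡2m ⟩
        2 * m                   ∎

lemma6p5 : (t : ℕ) → 2 ≤ t → (n r : ℕ) → (M : Matroid n) → IsSpike M t r
         → 4 * t ∸ 4 ≤ r → Connected M (2 * t ∸ 1)
lemma6p5 t 2≤t n r M (A , _ , leg-size , legs-disjoint , legs-cover , circuit-cocircuit) 4t-4≤r
         k k<2t-1 X (λX<k , k≤∣X∣ , k≤∣∁X∣) =
  <⇒≱ λX<k (connectivity-bound k 2≤t 4t≤r+4 k+2≤2t k≤∣X∣ k≤∣∁X∣)
  where
  open Spike M A leg-size legs-disjoint legs-cover circuit-cocircuit
  open Profile X
  open ≤-Reasoning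
  -- the hypotheses m ≥ 4t - 4 and k < 2t - 1 without truncated subtraction
  4t≤r+4 : 4 * t ≤ r + 4
  4t≤r+4 = begin
    4 * t              ≤⟨ m≤n+m∸n (4 * t) 4 ⟩
    4 + (4 * t ∸ 4)    ≤⟨ +-monoʳ-≤ 4 4t-4≤r ⟩
    4 + r              ≡⟨ +-comm 4 r ⟩
    r + 4              ∎
  k+2≤2t : k + 2 ≤ 2 * t
  k+2≤2t = begin
    k + 2              ≡⟨ +-comm k 2 ⟩
    suc (suc k)        ≤⟨ s≤s k<2t-1 ⟩
    1 + (2 * t ∸ 1)    ≡⟨ m+[n∸m]≡n (≤-trans (≤-trans (s≤s z≤n) 2≤t) (m≤m+n t (t + 0))) ⟩
    2 * t              ∎
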